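{- Let $\omega$ be a primitive $4$-th root of unity and specialize $a=b=c=\omega$ in the matrices $\alpha,\beta,\gamma$ below. Then for every closed loop $L$ in the honeycomb graph $2H$, the contribution of $L$ (the trace of the monodromy of the connection around $L$) is $2$.
   Context: $2H$ is the hexagonal tiling of the plane drawn with one family of edges horizontal, so edges come in three direction classes: horizontal, NE/SW and NW/SE. With $i=\sqrt{ -1}$, $$\alpha=\begin{bmatrix} ia&0\\0&\frac{1}{ia}\end{bmatrix},\quad \beta=\begin{bmatrix} ib& -ib-\frac{i}{b}\\ 0&\frac{1}{ib}\end{bmatrix},\quad \gamma=\begin{bmatrix}\frac{1}{ic}&0\\ -ic-\frac{i}{c}& ic\end{bmatrix}.$$ Traversing a NE/SW edge toward the northeast contributes $\alpha$ (southwest: $\alpha^{ -1}$); a NW/SE edge toward the northwest contributes $\beta$ (southeast: $\beta^{ -1}$); a horizontal edge toward the west contributes $\gamma$ (east: $\gamma^{ -1}$). The monodromy along a closed path $e_1,\dots,e_k$ is $M_{e_k}\cdots M_{e_1}$, and the contribution of the loop is its trace. -}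

module Defs where

open import Data.Integer as ℤ using (ℤ; +_; -[1+_])
open import Data.Product using (_×_; _,_)
open import Relation.Binary.Construct.Closure.ReflexiveTransitive using (Star; ε; _◅_)
open import Relation.Binary.PropositionalEquality using (_≡_)
open import Relation.Nullary using (¬_)

-- Gaussian integers ℤ[i] (contain all 4th roots of unity of ℂ)

record ℤi : Set where
  constructor _+i_
  field
    re : ℤ
    im : ℤ
open ℤi public

infixl 6 _+ᵢ_ _-ᵢ_
infixl 7 _*ᵢ_

_+ᵢ_ : ℤi → ℤi → ℤi
(a +i b) +ᵢ (c +i d) = (a ℤ.+ c) +i (b ℤ.+ d)

-ᵢ_ : ℤi → ℤi
-ᵢ (a +i b) = (ℤ.- a) +i (ℤ.- b)

_-ᵢ_ : ℤi → ℤi → ℤi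
x -ᵢ y = x +ᵢ (-ᵢ y)

_*ᵢ_ : ℤi → ℤi → ℤi
(a +i b) *ᵢ (c +i d) = (a ℤ.* c ℤ.- b ℤ.* d) +i (a ℤ.* d ℤ.+ b ℤ.* c)

0ᵢ 1ᵢ 2ᵢ iᵢ : ℤi
0ᵢ = (+ 0) +i (+ 0)
1ᵢ = (+ 1) +i (+ 0)
2ᵢ = (+ 2) +i (+ 0)
iᵢ = (+ 0) +i (+ 1)

-- primitive 4th root of unity: ω⁴ = 1 and ω² ≠ 1 (so the order is exactly 4)
IsPrimitive4thRoot : ℤi → Set
IsPrimitive4thRoot ω = (ω *ᵢ ω *ᵢ ω *ᵢ ω ≡ 1ᵢ) × ¬ (ω *ᵢ ω ≡ 1ᵢ)

record Mat2 : Set where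
  constructor mat
  field
    m11 m12 m21 m22 : ℤi
open Mat2 public

I₂ : Mat2
I₂ = mat 1ᵢ 0ᵢ 0ᵢ 1ᵢ

_·_ : Mat2 → Mat2 → Mat2
mat a b c d · mat e f g h =
  mat (a *ᵢ e +ᵢ b *ᵢ g) (a *ᵢ f +ᵢ b *ᵢ h)
      (c *ᵢ e +ᵢ d *ᵢ g) (c *ᵢ f +ᵢ d *ᵢ h)

trace : Mat2 → ℤi
trace (mat a _ _ d) = a +ᵢ d

-- inverse of a determinant-1 matrix (the adjugate); α, β, γ all have det 1
inv2 : Mat2 → Mat2
inv2 (mat a b c d) = mat d (-ᵢ b) (-ᵢ c) a

-- The matrices α, β, γ.  Each parameter x comes with its inverse x⁻
-- (x *ᵢ x⁻ ≡ 1ᵢ is assumed where used).  Since 1/i = -i we have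
-- 1/(i x) = (-i)·x⁻ and i/x = i·x⁻.

-iᵢ : ℤi
-iᵢ = -ᵢ iᵢ

αM : (a a⁻ : ℤi) → Mat2
αM a a⁻ = mat (iᵢ *ᵢ a) 0ᵢ 0ᵢ (-iᵢ *ᵢ a⁻)

βM : (b b⁻ : ℤi) → Mat2
βM b b⁻ = mat (iᵢ *ᵢ b) (-ᵢ (iᵢ *ᵢ b) -ᵢ iᵢ *ᵢ b⁻) 0ᵢ (-iᵢ *ᵢ b⁻)

γM : (c c⁻ : ℤi) → Mat2
γM c c⁻ = mat (-iᵢ *ᵢ c⁻) 0ᵢ (-ᵢ (iᵢ *ᵢ c) -ᵢ iᵢ *ᵢ c⁻) (iᵢ *ᵢ c)

-- The honeycomb graph 2H with one edge family horizontal.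
-- Vertices: L u v (left vertex of a flat-top hexagon: edges W, NE, SE)
--           R u v (right vertex: edges E, NW, SW).
-- Edges: L u v — R u v         horizontal (R is west of L)
--        L u v — R (u+1) v     NE/SW     (R is northeast of L)
--        L u v — R u (v+1)     NW/SE     (R is southeast of L)

data Vertex : Set where
  L R : ℤ → ℤ → Vertex

data Step : Vertex → Vertex → Set where
  west  : ∀ u v → Step (L u v) (R u v)
  east  : ∀ u v → Step (R u v) (L u v)
  ne    : ∀ u v → Step (L u v) (R (u ℤ.+ + 1) v)
  sw    : ∀ u v → Step (R (u ℤ.+ + 1) v) (L u v)
  nw    : ∀ u v → Step (R u (v ℤ.+ + 1)) (L u v)
  se    : ∀ u v → Step (L u v) (R u (v ℤ.+ + 1))

Path : Vertex → Vertex → Set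
Path = Star Step

module Connection (a a⁻ b b⁻ c c⁻ : ℤi) where

  stepMat : ∀ {x y} → Step x y → Mat2
  stepMat (west u v) = γM c c⁻
  stepMat (east u v) = inv2 (γM c c⁻)
  stepMat (ne u v)   = αM a a⁻
  stepMat (sw u v)   = inv2 (αM a a⁻)
  stepMat (nw u v)   = βM b b⁻
  stepMat (se u v)   = inv2 (βM b b⁻)

  monodromy : ∀ {x y} → Path x y → Mat2
  monodromy ε        = I₂
  monodromy (e ◅ p)  = monodromy p · stepMat e

  contribution : ∀ {x} → Path x x → ℤi
  contribution p = trace (monodromy p)

{-# OPTIONS --safe #-}
module Submission where

open import Defs
open import Data.Bool using (Bool; true; false; not; _∧_; _xor_)
open import Data.Bool.Properties using (not-involutive; xor-same; ∧-zeroʳ)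
open import Data.Empty using (⊥-elim)
open import Data.Integer as ℤ using (ℤ; +_; -[1+_]; ∣_∣)
open import Data.Integer.Properties using (abs-*)
open import Data.Integer.Tactic.RingSolver using (solve-∀)
import Data.Nat as ℕ
open import Data.Nat.Properties using (m*n≡1⇒m≡1; m*n≡1⇒n≡1)
open import Data.Product using (_×_; _,_)
open import Data.Sum using (_⊎_; inj₁; inj₂)
open import Relation.Binary.Construct.Closure.ReflexiveTransitive using (ε; _◅_)
open import Relation.Binary.PropositionalEquality
  using (_≡_; refl; cong; cong₂; sym; trans; module ≡-Reasoning)
open import Relation.Nullary using (¬_)

-- For ω = ±i every edge matrix collapses to the same scalar: −I when ω = i and
-- I when ω = −i.  The monodromy of a path is then (−I)^length or I, and since
-- 2H is bipartite every loop has even length, so the monodromy of a loop is I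
-- and its trace is 2.  That ω is ±i follows from the norm: ω is a unit of
-- ℤ[i], hence one of ±1, ±i, and ω² ≠ 1 leaves ±i.

norm : ℤi → ℤ
norm (a +i b) = a ℤ.* a ℤ.+ b ℤ.* b

norm-*ᵢ : ∀ x y → norm (x *ᵢ y) ≡ norm x ℤ.* norm y
norm-*ᵢ (a +i b) (c +i d) = brahmagupta a b c d
  where
  brahmagupta : ∀ a b c d →
    (a ℤ.* c ℤ.- b ℤ.* d) ℤ.* (a ℤ.* c ℤ.- b ℤ.* d) ℤ.+ (a ℤ.* d ℤ.+ b ℤ.* c) ℤ.* (a ℤ.* d ℤ.+ b ℤ.* c)
      ≡ (a ℤ.* a ℤ.+ b ℤ.* b) ℤ.* (c ℤ.* c ℤ.+ d ℤ.* d)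
  brahmagupta = solve-∀

∣norm∣*∣norm∣≡1 : ∀ x y → x *ᵢ y ≡ 1ᵢ → ∣ norm x ∣ ℕ.* ∣ norm y ∣ ≡ 1
∣norm∣*∣norm∣≡1 x y xy≡1 = begin
  ∣ norm x ∣ ℕ.* ∣ norm y ∣  ≡⟨ sym (abs-* (norm x) (norm y)) ⟩
  ∣ norm x ℤ.* norm y ∣      ≡⟨ cong ∣_∣ (sym (norm-*ᵢ x y)) ⟩
  ∣ norm (x *ᵢ y) ∣          ≡⟨ cong (λ z → ∣ norm z ∣) xy≡1 ⟩
  1                          ∎
  where open ≡-Reasoning

data GaussianUnit : ℤi → Set where
  unit-1  : GaussianUnit 1ᵢ
  unit-−1 : GaussianUnit (-ᵢ 1ᵢ)
  unit-i  : GaussianUnit iᵢ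
  unit-−i : GaussianUnit -iᵢ

∣norm∣≡1⇒unit : ∀ x → ∣ norm x ∣ ≡ 1 → GaussianUnit x
∣norm∣≡1⇒unit ((+ 0) +i (+ 0)) ()
∣norm∣≡1⇒unit ((+ 0) +i (+ 1)) _ = unit-i
∣norm∣≡1⇒unit ((+ 0) +i (+ ℕ.suc (ℕ.suc _))) ()
∣norm∣≡1⇒unit ((+ 0) +i -[1+ 0 ]) _ = unit-−i
∣norm∣≡1⇒unit ((+ 0) +i -[1+ ℕ.suc _ ]) ()
∣norm∣≡1⇒unit ((+ 1) +i (+ 0)) _ = unit-1
∣norm∣≡1⇒unit ((+ 1) +i (+ ℕ.suc _)) ()
∣norm∣≡1⇒unit ((+ 1) +i -[1+ _ ]) ()
∣norm∣≡1⇒unit ((+ ℕ.suc (ℕ.suc _)) +i (+ 0)) ()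
∣norm∣≡1⇒unit ((+ ℕ.suc (ℕ.suc _)) +i (+ ℕ.suc _)) ()
∣norm∣≡1⇒unit ((+ ℕ.suc (ℕ.suc _)) +i -[1+ _ ]) ()
∣norm∣≡1⇒unit (-[1+ 0 ] +i (+ 0)) _ = unit-−1
∣norm∣≡1⇒unit (-[1+ 0 ] +i (+ ℕ.suc _)) ()
∣norm∣≡1⇒unit (-[1+ 0 ] +i -[1+ _ ]) ()
∣norm∣≡1⇒unit (-[1+ ℕ.suc _ ] +i (+ 0)) ()
∣norm∣≡1⇒unit (-[1+ ℕ.suc _ ] +i (+ ℕ.suc _)) ()
∣norm∣≡1⇒unit (-[1+ ℕ.suc _ ] +i -[1+ _ ]) ()

*ᵢ≡1⇒unitˡ : ∀ x y → x *ᵢ y ≡ 1ᵢ → GaussianUnit x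
*ᵢ≡1⇒unitˡ x y xy≡1 = ∣norm∣≡1⇒unit x (m*n≡1⇒m≡1 ∣ norm x ∣ ∣ norm y ∣ (∣norm∣*∣norm∣≡1 x y xy≡1))

*ᵢ≡1⇒unitʳ : ∀ x y → x *ᵢ y ≡ 1ᵢ → GaussianUnit y
*ᵢ≡1⇒unitʳ x y xy≡1 = ∣norm∣≡1⇒unit y (m*n≡1⇒n≡1 ∣ norm x ∣ ∣ norm y ∣ (∣norm∣*∣norm∣≡1 x y xy≡1))

square≢1⇒±i : ∀ ω ω⁻ → ¬ (ω *ᵢ ω ≡ 1ᵢ) → ω *ᵢ ω⁻ ≡ 1ᵢ →
  (ω ≡ iᵢ × ω⁻ ≡ -iᵢ) ⊎ (ω ≡ -iᵢ × ω⁻ ≡ iᵢ)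
square≢1⇒±i ω ω⁻ ω²≢1 ωω⁻≡1 = cases (*ᵢ≡1⇒unitˡ ω ω⁻ ωω⁻≡1) (*ᵢ≡1⇒unitʳ ω ω⁻ ωω⁻≡1) ω²≢1 ωω⁻≡1
  where
  cases : ∀ {ω ω⁻} → GaussianUnit ω → GaussianUnit ω⁻ → ¬ (ω *ᵢ ω ≡ 1ᵢ) → ω *ᵢ ω⁻ ≡ 1ᵢ →
    (ω ≡ iᵢ × ω⁻ ≡ -iᵢ) ⊎ (ω ≡ -iᵢ × ω⁻ ≡ iᵢ)
  cases unit-1  _       ω²≢1 _ = ⊥-elim (ω²≢1 refl)
  cases unit-−1 _       ω²≢1 _ = ⊥-elim (ω²≢1 refl)
  cases unit-i  unit-−i _ _ = inj₁ (refl , refl)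
  cases unit-−i unit-i  _ _ = inj₂ (refl , refl)
  cases unit-i  unit-1  _ ()
  cases unit-i  unit-−1 _ ()
  cases unit-i  unit-i  _ ()
  cases unit-−i unit-1  _ ()
  cases unit-−i unit-−1 _ ()
  cases unit-−i unit-−i _ ()

signI₂ : Bool → Mat2
signI₂ false = I₂
signI₂ true  = mat (-ᵢ 1ᵢ) 0ᵢ 0ᵢ (-ᵢ 1ᵢ)

signI₂-step : ∀ s b → signI₂ (s ∧ b) · signI₂ s ≡ signI₂ (s ∧ not b)
signI₂-step false _     = refl
signI₂-step true  false = refl
signI₂-step true  true  = refl

side : Vertex → Bool
side (L _ _) = false
side (R _ _) = true

step-flips-side : ∀ {x y} → Step x y → ∀ b → side x xor b ≡ not (side y xor b)
step-flips-side (west _ _) b = sym (not-involutive b)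
step-flips-side (east _ _) _ = refl
step-flips-side (ne _ _)   b = sym (not-involutive b)
step-flips-side (sw _ _)   _ = refl
step-flips-side (nw _ _)   _ = refl
step-flips-side (se _ _)   b = sym (not-involutive b)

module ScalarConnection (a a⁻ b b⁻ c c⁻ : ℤi) (s : Bool)
  (stepMat≡signI₂ : ∀ {x y} (e : Step x y) → Connection.stepMat a a⁻ b b⁻ c c⁻ e ≡ signI₂ s)
  where
  open Connection a a⁻ b b⁻ c c⁻

  signI₂-at-same-side : ∀ x → signI₂ (s ∧ (side x xor side x)) ≡ I₂
  signI₂-at-same-side x = cong signI₂ (trans (cong (s ∧_) (xor-same (side x))) (∧-zeroʳ s))

  monodromy≡signI₂ : ∀ {x y} (p : Path x y) → monodromy p ≡ signI₂ (s ∧ (side x xor side y))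
  monodromy≡signI₂ {x} ε = sym (signI₂-at-same-side x)
  monodromy≡signI₂ {x} {y} (_◅_ {j = z} e p) = begin
    monodromy p · stepMat e                           ≡⟨ cong₂ _·_ (monodromy≡signI₂ p) (stepMat≡signI₂ e) ⟩
    signI₂ (s ∧ (side z xor side y)) · signI₂ s       ≡⟨ signI₂-step s (side z xor side y) ⟩
    signI₂ (s ∧ not (side z xor side y))              ≡⟨ cong (λ b → signI₂ (s ∧ b)) (sym (step-flips-side e (side y))) ⟩
    signI₂ (s ∧ (side x xor side y))                  ∎
    where open ≡-Reasoning

  contribution≡2 : ∀ {x} (loop : Path x x) → contribution loop ≡ 2ᵢ
  contribution≡2 {x} loop = cong trace (trans (monodromy≡signI₂ loop) (signI₂-at-same-side x))

stepMat-i≡−I₂ : ∀ {x y} (e : Step x y) → Connection.stepMat iᵢ -iᵢ iᵢ -iᵢ iᵢ -iᵢ e ≡ signI₂ true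
stepMat-i≡−I₂ (west _ _) = refl
stepMat-i≡−I₂ (east _ _) = refl
stepMat-i≡−I₂ (ne _ _)   = refl
stepMat-i≡−I₂ (sw _ _)   = refl
stepMat-i≡−I₂ (nw _ _)   = refl
stepMat-i≡−I₂ (se _ _)   = refl

stepMat-−i≡I₂ : ∀ {x y} (e : Step x y) → Connection.stepMat -iᵢ iᵢ -iᵢ iᵢ -iᵢ iᵢ e ≡ signI₂ false
stepMat-−i≡I₂ (west _ _) = refl
stepMat-−i≡I₂ (east _ _) = refl
stepMat-−i≡I₂ (ne _ _)   = refl
stepMat-−i≡I₂ (sw _ _)   = refl
stepMat-−i≡I₂ (nw _ _)   = refl
stepMat-−i≡I₂ (se _ _)   = refl

mainTheorem3 : (ω ω⁻ : ℤi) → IsPrimitive4thRoot ω → ω *ᵢ ω⁻ ≡ 1ᵢ →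
    (x : Vertex) (loop : Path x x) →
    Connection.contribution ω ω⁻ ω ω⁻ ω ω⁻ loop ≡ 2ᵢ
mainTheorem3 ω ω⁻ (_ , ω²≢1) ωω⁻≡1 x loop with square≢1⇒±i ω ω⁻ ω²≢1 ωω⁻≡1
... | inj₁ (refl , refl) = ScalarConnection.contribution≡2 _ _ _ _ _ _ true  stepMat-i≡−I₂ loop
... | inj₂ (refl , refl) = ScalarConnection.contribution≡2 _ _ _ _ _ _ false stepMat-−i≡I₂ loop
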